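{- Let $G=(A\cup P,\mathcal{E})$ be an instance of the rank-maximal matching problem, let $a_1\in A$, and let $P_1$ be the set of rank one posts of $a_1$. If $P_1$ contains a non-$f$-post, then in every rank-maximal matching of $G$, $a_1$ is matched to a non-$f$-post belonging to $P_1$ (in particular to one of his first choices).
   Context: An instance is a bipartite graph $G=(A\cup P,\mathcal{E})$ ($A$ = applicants, $P$ = posts) in which each edge $(a,p)$ has a positive integer rank $\mathrm{rank}(a,p)$ describing $a$'s preference list (ties allowed; smaller rank = more preferred; rank one posts are the most preferred). Let $r$ be the largest rank. A matching is a set of edges no two sharing an endpoint. The signature of a matching $M$ is $(x_1,\dots,x_r)$ with $x_i$ the number of applicants matched in $M$ by a rank $i$ edge; a matching is rank-maximal if its signature is lexicographically largest among all matchings. $G_1$ denotes the subgraph of $G$ consisting of the rank one edges. For a bipartite graph $K$ with a maximum matching $M$, a vertex is even (resp. odd) if it is reachable from some vertex unmatched in $M$ by an $M$-alternating path of even (resp. odd) length, and unreachable otherwise; the sets $E(K),O(K),U(K)$ of even, odd and unreachable vertices do not depend on the choice of $M$. A post is an $f$-post (with respect to $a_1$) if it belongs to $O(K)\cup U(K)$, where $K$ is the graph obtained from $G_1$ by deleting the vertex $a_1$; all other posts are non-$f$-posts. -}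

module Defs where

open import Data.Nat using (ℕ; zero; suc; _+_; _≤_; _<_; _≡ᵇ_)
open import Data.Fin using (Fin)
open import Data.Bool using (Bool; true; false)
open import Data.Maybe using (Maybe; just; nothing; is-just)
open import Data.List using (List; filter; length; allFin)
open import Data.Product using (Σ; ∃; _×_; _,_)
open import Relation.Binary.PropositionalEquality using (_≡_; _≢_)
open import Relation.Nullary using (¬_)
open import Data.Bool using (T)
open import Relation.Nullary.Decidable using (T?)

-- An instance with nA applicants (Fin nA) and nP posts (Fin nP).
-- Rank a p ≡ nothing : no edge (a,p);  Rank a p ≡ just r : edge of rank r.
Rank : ℕ → ℕ → Set
Rank nA nP = Fin nA → Fin nP → Maybe ℕ

PositiveRanks : ∀ {nA nP} → Rank nA nP → Set
PositiveRanks {nA} {nP} rank = ∀ (a : Fin nA) (p : Fin nP) (r : ℕ) → rank a p ≡ just r → 1 ≤ r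

count : ∀ {n} → (Fin n → Bool) → ℕ
count {n} f = length (filter (λ i → T? (f i)) (allFin n))

record Matching {nA nP : ℕ} (rank : Rank nA nP) : Set where
  field
    mate  : Fin nA → Maybe (Fin nP)
    edge  : ∀ a p → mate a ≡ just p → ∃ λ r → rank a p ≡ just r
    inj   : ∀ a a' p → mate a ≡ just p → mate a' ≡ just p → a ≡ a'
open Matching public

size : ∀ {nA nP} {rank : Rank nA nP} → Matching rank → ℕ
size M = count (λ a → is-just (mate M a))

matchedWithRank : ∀ {nA nP} (rank : Rank nA nP) → Matching rank → ℕ → Fin nA → Bool
matchedWithRank rank M i a with mate M a
... | nothing = false
... | just p with rank a p
...   | nothing = false
...   | just r = r ≡ᵇ i

-- signature: i ↦ x_i  (x_i = 0 for i = 0 and for i > r)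
signature : ∀ {nA nP} {rank : Rank nA nP} → Matching rank → ℕ → ℕ
signature {rank = rank} M i = count (matchedWithRank rank M i)

_<lex_ : (ℕ → ℕ) → (ℕ → ℕ) → Set
s <lex t = ∃ λ i → (∀ j → j < i → s j ≡ t j) × s i < t i

RankMaximal : ∀ {nA nP} (rank : Rank nA nP) → Matching rank → Set
RankMaximal rank M = ¬ (Σ (Matching rank) λ M' → signature M <lex signature M')

-- The graph K = G_1 minus the vertex a₁.

KEdge : ∀ {nA nP} → Rank nA nP → Fin nA → Fin nA → Fin nP → Set
KEdge rank a₁ a p = (a ≢ a₁) × (rank a p ≡ just 1)

record KMatching {nA nP : ℕ} (rank : Rank nA nP) (a₁ : Fin nA) : Set where
  field
    kmatch : Matching rank
    kedge  : ∀ a p → mate kmatch a ≡ just p → KEdge rank a₁ a p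
open KMatching public

IsMaximumK : ∀ {nA nP} {rank : Rank nA nP} {a₁ : Fin nA} → KMatching rank a₁ → Set
IsMaximumK {rank = rank} {a₁} N = ∀ (N' : KMatching rank a₁) → size (kmatch N') ≤ size (kmatch N)

PostUnmatched : ∀ {nA nP} {rank : Rank nA nP} → Matching rank → Fin nP → Set
PostUnmatched {nA} M p = ∀ (a : Fin nA) → mate M a ≢ just p

-- p is an even vertex of K w.r.t. the (maximum) matching N of K:
-- p is reachable from an unmatched vertex by an N-alternating path of even
-- length.  In a bipartite graph such a path to a post starts at an unmatched
-- post, and reachability by alternating walks and by alternating paths
-- coincide; the path grows by one non-matching edge (p' , a) of K followed by
-- the matching edge (a , N a).
data EvenPost {nA nP : ℕ} (rank : Rank nA nP) (a₁ : Fin nA) (N : KMatching rank a₁)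
       : Fin nP → Set where
  start : ∀ p → PostUnmatched (kmatch N) p → EvenPost rank a₁ N p
  step  : ∀ p' a p → EvenPost rank a₁ N p' → KEdge rank a₁ a p'
        → mate (kmatch N) a ≢ just p' → mate (kmatch N) a ≡ just p
        → EvenPost rank a₁ N p

-- non-f-post  (p ∉ O(K) ∪ U(K), i.e. p ∈ E(K))
NonFPost : ∀ {nA nP} (rank : Rank nA nP) (a₁ : Fin nA) (N : KMatching rank a₁) → Fin nP → Set
NonFPost = EvenPost

module Submission where

-- Let N be a maximum matching of K.  The proof compares the number of rank-one
-- edges of M with |N|, using two facts about alternating paths in K:
--   * (free-along) if p is even, flipping the even alternating path that ends
--     in p yields a matching of K of size |N| leaving p free; adding the edge
--     (a₁,p) gives a rank-one matching of size |N|+1, so M has ≥ |N|+1 rank-one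
--     edges (rankMaximal-exceeds-N);
--   * (augment-or-even) if a matching L of K leaves a post q free, then either q
--     is even w.r.t. N, or following the N-edge at q and the L-edge at its
--     applicant (an alternating walk which makes L agree with N at one more
--     applicant per step) ends in an augmentation of L.
-- The rank-one edges of M other than the one at a₁ form a matching L = kPart M
-- of K with |L| ≤ |N|.  Hence a₁ is matched in M by a rank-one edge (a₁,q) and
-- |L| = |N|, so L is maximum and leaves q free; by augment-or-even q is even.

open import Defs
open import Data.Nat using (ℕ; zero; suc; _+_; _≤_; _<_; s≤s; s≤s⁻¹; z≤n)
open import Data.Nat.Properties
  using (+-suc; ≤-trans; n≤1+n; m≤m+n; ≮⇒≥; n≮n; ≡ᵇ⇒≡)
open import Data.Fin using (Fin; zero; suc)
open import Data.Fin.Properties using (_≟_; any?)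
import Data.Fin.Properties as Fin
open import Data.Bool using (Bool; true; false; T; if_then_else_)
open import Data.Maybe using (Maybe; just; nothing; is-just)
open import Data.Maybe.Properties using (just-injective)
import Data.Maybe.Properties as Maybe
open import Data.List using (List; []; _∷_; filter; length; tabulate)
open import Data.List.Membership.Propositional using (_∈_)
import Data.List.Membership.DecPropositional as DecMembership
open import Data.List.Relation.Unary.Any using (here; there)
open import Data.Vec.Functional using (updateAt)
open import Data.Vec.Functional.Properties using (updateAt-updates; updateAt-minimal)
open import Data.Product using (Σ; ∃; _×_; _,_; proj₁; proj₂)
open import Data.Sum using (_⊎_; inj₁; inj₂)
open import Data.Empty using (⊥-elim)
open import Data.Unit using (tt)
open import Function using (_∘_; id; const)
open import Relation.Binary.PropositionalEquality
open import Relation.Nullary using (yes; no; does)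
open import Relation.Nullary.Decidable using (T?; dec-true; dec-false)

tally : ∀ {n} → (Fin n → Bool) → ℕ
tally {zero}  f = 0
tally {suc n} f = (if f zero then 1 else 0) + tally (f ∘ suc)

count-tabulate : ∀ {m n} (f : Fin m → Bool) (h : Fin n → Fin m) →
  length (filter (λ i → T? (f i)) (tabulate h)) ≡ tally (f ∘ h)
count-tabulate {n = zero}  f h = refl
count-tabulate {n = suc n} f h with f (h zero)
... | true  = cong suc (count-tabulate f (h ∘ suc))
... | false = count-tabulate f (h ∘ suc)

count≡tally : ∀ {n} (f : Fin n → Bool) → count f ≡ tally f
count≡tally f = count-tabulate f id

tally-cong : ∀ {n} {f g : Fin n → Bool} → (∀ i → f i ≡ g i) → tally f ≡ tally g
tally-cong {zero}  e = refl
tally-cong {suc n} e = cong₂ _+_ (cong (λ b → if b then 1 else 0) (e zero)) (tally-cong (e ∘ suc))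

count-cong : ∀ {n} {f g : Fin n → Bool} → (∀ i → f i ≡ g i) → count f ≡ count g
count-cong {f = f} {g} e = trans (count≡tally f) (trans (tally-cong e) (sym (count≡tally g)))

count-≤ : ∀ {n} (f : Fin n → Bool) → count f ≤ n
count-≤ f rewrite count≡tally f = tally-≤ f
  where
  tally-≤ : ∀ {n} (f : Fin n → Bool) → tally f ≤ n
  tally-≤ {zero}  f = z≤n
  tally-≤ {suc n} f with f zero
  ... | true  = s≤s (tally-≤ (f ∘ suc))
  ... | false = ≤-trans (tally-≤ (f ∘ suc)) (n≤1+n n)

count-none : ∀ {n} (f : Fin n → Bool) → (∀ i → f i ≡ false) → count f ≡ 0
count-none f none rewrite count≡tally f = tally-none f none
  where
  tally-none : ∀ {n} (f : Fin n → Bool) → (∀ i → f i ≡ false) → tally f ≡ 0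
  tally-none {zero}  f none = refl
  tally-none {suc n} f none rewrite none zero = tally-none (f ∘ suc) (none ∘ suc)

count-insert : ∀ {n} (f g : Fin n → Bool) (i : Fin n) → f i ≡ false → g i ≡ true
  → (∀ j → j ≢ i → f j ≡ g j) → count g ≡ suc (count f)
count-insert f g i fi gi same rewrite count≡tally f | count≡tally g = tally-insert f g i fi gi same
  where
  tally-insert : ∀ {n} (f g : Fin n → Bool) (i : Fin n) → f i ≡ false → g i ≡ true
    → (∀ j → j ≢ i → f j ≡ g j) → tally g ≡ suc (tally f)
  tally-insert f g zero fi gi same rewrite fi | gi =
    cong suc (sym (tally-cong (λ j → same (suc j) (λ ()))))
  tally-insert f g (suc i) fi gi same = begin
    (if g zero then 1 else 0) + tally (g ∘ suc)
      ≡⟨ cong₂ _+_ (cong (λ b → if b then 1 else 0) (sym (same zero (λ ()))))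
                   (tally-insert (f ∘ suc) (g ∘ suc) i fi gi (λ j j≢i → same (suc j) (j≢i ∘ Fin.suc-injective))) ⟩
    (if f zero then 1 else 0) + suc (tally (f ∘ suc))
      ≡⟨ +-suc _ _ ⟩
    suc (tally f) ∎
    where open ≡-Reasoning

assign : ∀ {A : Set} {n} → (Fin n → A) → Fin n → A → Fin n → A
assign f b v = updateAt f b (const v)

assign-at : ∀ {A : Set} {n} (f : Fin n → A) b v → assign f b v b ≡ v
assign-at f b v = updateAt-updates b f

assign-other : ∀ {A : Set} {n} (f : Fin n → A) b v c → c ≢ b → assign f b v c ≡ f c
assign-other f b v c c≢b = updateAt-minimal c b f c≢b

assign-cases : ∀ {A : Set} {n} (f : Fin n → A) b v c →
  (c ≡ b × assign f b v c ≡ v) ⊎ (c ≢ b × assign f b v c ≡ f c)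
assign-cases f b v c with c ≟ b
... | yes refl = inj₁ (refl , assign-at f b v)
... | no c≢b   = inj₂ (c≢b , assign-other f b v c c≢b)

assign-nothing-sub : ∀ {A : Set} {n} (f : Fin n → Maybe A) a c {p} → assign f a nothing c ≡ just p → f c ≡ just p
assign-nothing-sub f a c fc with assign-cases f a nothing c
... | inj₁ (_ , x) with () ← trans (sym x) fc
... | inj₂ (_ , x) = trans (sym x) fc

module _ {nA nP : ℕ} {rank : Rank nA nP} where

  reassign : (M : Matching rank) (b : Fin nA) (q : Fin nP) → PostUnmatched M q
    → (∃ λ r → rank b q ≡ just r) → Matching rank
  reassign M b q q-free bq-edge = record { mate = m ; edge = m-edge ; inj = m-inj }
    where
    m : Fin nA → Maybe (Fin nP)
    m = assign (mate M) b (just q)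
    m-edge : ∀ a p → m a ≡ just p → ∃ λ r → rank a p ≡ just r
    m-edge a p ma with assign-cases (mate M) b (just q) a
    ... | inj₁ (refl , mb) rewrite just-injective (trans (sym mb) ma) = bq-edge
    ... | inj₂ (_ , ma')  = edge M a p (trans (sym ma') ma)
    m-inj : ∀ a a' p → m a ≡ just p → m a' ≡ just p → a ≡ a'
    m-inj a a' p ma ma' with assign-cases (mate M) b (just q) a | assign-cases (mate M) b (just q) a'
    ... | inj₁ (a≡b , _) | inj₁ (a'≡b , _) = trans a≡b (sym a'≡b)
    ... | inj₁ (_ , x)   | inj₂ (_ , y)    = ⊥-elim (q-free a' (trans (sym y) (trans ma' (trans (sym ma) x))))
    ... | inj₂ (_ , x)   | inj₁ (_ , y)    = ⊥-elim (q-free a (trans (sym x) (trans ma (trans (sym ma') y))))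
    ... | inj₂ (_ , x)   | inj₂ (_ , y)    = inj M a a' p (trans (sym x) ma) (trans (sym y) ma')

  module _ (M : Matching rank) (b : Fin nA) (q : Fin nP) (q-free : PostUnmatched M q)
           (bq-edge : ∃ λ r → rank b q ≡ just r) where

    private
      M' : Matching rank
      M' = reassign M b q q-free bq-edge

    reassign-frees : ∀ s → mate M b ≡ just s → q ≢ s → PostUnmatched M' s
    reassign-frees s mb q≢s c mc with assign-cases (mate M) b (just q) c
    ... | inj₁ (_ , x)   = q≢s (just-injective (trans (sym x) mc))
    ... | inj₂ (c≢b , x) = c≢b (inj M c b s (trans (sym x) mc) mb)

    size-reassign-matched : ∀ s → mate M b ≡ just s → size M' ≡ size M
    size-reassign-matched s mb = count-cong same-support
      where
      same-support : ∀ c → is-just (mate M' c) ≡ is-just (mate M c)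
      same-support c with assign-cases (mate M) b (just q) c
      ... | inj₁ (refl , x) rewrite x | mb = refl
      ... | inj₂ (_ , x)    rewrite x = refl

    size-reassign-unmatched : mate M b ≡ nothing → size M' ≡ suc (size M)
    size-reassign-unmatched mb =
      count-insert (λ c → is-just (mate M c)) (λ c → is-just (mate M' c)) b
        (cong is-just mb) (cong is-just (assign-at (mate M) b (just q)))
        (λ c c≢b → cong is-just (sym (assign-other (mate M) b (just q) c c≢b)))

  unmatch : Matching rank → Fin nA → Matching rank
  unmatch M a = record
    { mate = assign (mate M) a nothing
    ; edge = λ c p mc → edge M c p (assign-nothing-sub (mate M) a c mc)
    ; inj  = λ c c' p mc mc' → inj M c c' p (assign-nothing-sub (mate M) a c mc) (assign-nothing-sub (mate M) a c' mc')
    }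

  unmatch-frees : ∀ (M : Matching rank) a {q} → mate M a ≡ just q → PostUnmatched (unmatch M a) q
  unmatch-frees M a ma c mc with assign-cases (mate M) a nothing c
  ... | inj₁ (_ , x)   with () ← trans (sym x) mc
  ... | inj₂ (c≢a , x) = c≢a (inj M c a _ (trans (sym x) mc) ma)

  size-unmatch-matched : ∀ (M : Matching rank) a {p} → mate M a ≡ just p → size M ≡ suc (size (unmatch M a))
  size-unmatch-matched M a ma =
    count-insert (λ c → is-just (mate (unmatch M a) c)) (λ c → is-just (mate M c)) a
      (cong is-just (assign-at (mate M) a nothing)) (cong is-just ma)
      (λ c c≢a → cong is-just (assign-other (mate M) a nothing c c≢a))

  size-unmatch-unmatched : ∀ (M : Matching rank) a → mate M a ≡ nothing → size (unmatch M a) ≡ size M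
  size-unmatch-unmatched M a ma = count-cong same-support
    where
    same-support : ∀ c → is-just (mate (unmatch M a) c) ≡ is-just (mate M c)
    same-support c with assign-cases (mate M) a nothing c
    ... | inj₁ (refl , x) rewrite x | ma = refl
    ... | inj₂ (_ , x)    rewrite x = refl

RankOne : ∀ {nA nP} {rank : Rank nA nP} → Matching rank → Set
RankOne {rank = rank} M = ∀ a p → mate M a ≡ just p → rank a p ≡ just 1

module _ {nA nP : ℕ} {rank : Rank nA nP} where

  reassign-rankOne : ∀ (M : Matching rank) b q q-free (bq : rank b q ≡ just 1)
    → RankOne M → RankOne (reassign M b q q-free (1 , bq))
  reassign-rankOne M b q q-free bq rank-one a p ma with assign-cases (mate M) b (just q) a
  ... | inj₁ (refl , x) rewrite just-injective (trans (sym x) ma) = bq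
  ... | inj₂ (_ , x)    = rank-one a p (trans (sym x) ma)

  unmatch-rankOne : ∀ (M : Matching rank) a → RankOne M → RankOne (unmatch M a)
  unmatch-rankOne M a rank-one c p mc = rank-one c p (assign-nothing-sub (mate M) a c mc)

  matchedWithRank-true : ∀ (M : Matching rank) i a → matchedWithRank rank M i a ≡ true
    → ∃ λ p → mate M a ≡ just p × rank a p ≡ just i
  matchedWithRank-true M i a t with mate M a in ma
  ... | just p with rank a p in r
  ...   | just k = p , refl , trans r (cong just (≡ᵇ⇒≡ k i (subst T (sym t) tt)))

  matchedWithRank-zero : PositiveRanks rank → ∀ (M : Matching rank) a → matchedWithRank rank M 0 a ≡ false
  matchedWithRank-zero positive M a with mate M a
  ... | nothing = refl
  ... | just p with rank a p in r
  ...   | nothing = refl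
  ...   | just k with positive a p k r
  ...     | s≤s _ = refl

  matchedWithRank-rankOne : ∀ (M : Matching rank) → RankOne M → ∀ a → matchedWithRank rank M 1 a ≡ is-just (mate M a)
  matchedWithRank-rankOne M rank-one a with mate M a in ma
  ... | nothing = refl
  ... | just p rewrite rank-one a p ma = refl

  signature-rankOne : ∀ (M : Matching rank) → RankOne M → signature M 1 ≡ size M
  signature-rankOne M rank-one = count-cong (matchedWithRank-rankOne M rank-one)

  -- Since x₀ = 0 for every matching, a rank-maximal matching has the largest
  -- number of rank-one edges.
  rankMaximal-maximizes-rankOne : PositiveRanks rank → ∀ (M : Matching rank) → RankMaximal rank M
    → ∀ (Y : Matching rank) → signature Y 1 ≤ signature M 1
  rankMaximal-maximizes-rankOne positive M rank-maximal Y =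
    ≮⇒≥ (λ more → rank-maximal (Y , 1 , agree-below-1 , more))
    where
    signature-zero : ∀ (X : Matching rank) → signature X 0 ≡ 0
    signature-zero X = count-none _ (matchedWithRank-zero positive X)
    agree-below-1 : ∀ j → j < 1 → signature M j ≡ signature Y j
    agree-below-1 zero _ = trans (signature-zero M) (sym (signature-zero Y))
    agree-below-1 (suc j) (s≤s ())

  rankOneMate : Matching rank → Fin nA → Maybe (Fin nP)
  rankOneMate M a = if matchedWithRank rank M 1 a then mate M a else nothing

  rankOneMate-sub : ∀ (M : Matching rank) a p → rankOneMate M a ≡ just p → mate M a ≡ just p × rank a p ≡ just 1
  rankOneMate-sub M a p ka with matchedWithRank rank M 1 a in t
  ... | true with matchedWithRank-true M 1 a t
  ...   | p' , ma , r rewrite just-injective (trans (sym ma) ka) = ka , r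

  rankOnePart : Matching rank → Matching rank
  rankOnePart M = record
    { mate = rankOneMate M
    ; edge = λ a p ka → 1 , proj₂ (rankOneMate-sub M a p ka)
    ; inj  = λ a a' p ka ka' → inj M a a' p (proj₁ (rankOneMate-sub M a p ka)) (proj₁ (rankOneMate-sub M a' p ka'))
    }

  rankOnePart-rankOne : ∀ (M : Matching rank) → RankOne (rankOnePart M)
  rankOnePart-rankOne M a p ka = proj₂ (rankOneMate-sub M a p ka)

  signature-rankOnePart : ∀ (M : Matching rank) → signature M 1 ≡ size (rankOnePart M)
  signature-rankOnePart M = count-cong matched-in-part
    where
    matched-in-part : ∀ a → matchedWithRank rank M 1 a ≡ is-just (rankOneMate M a)
    matched-in-part a with matchedWithRank rank M 1 a in t
    ... | false = refl
    ... | true with matchedWithRank-true M 1 a t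
    ...   | _ , ma , _ rewrite ma = refl

module _ {nA nP : ℕ} {rank : Rank nA nP} (a₁ : Fin nA) where

  asK : (M : Matching rank) → RankOne M → mate M a₁ ≡ nothing → KMatching rank a₁
  asK M rank-one a₁-free = record { kmatch = M ; kedge = λ a p ma → avoids a p ma , rank-one a p ma }
    where
    avoids : ∀ a p → mate M a ≡ just p → a ≢ a₁
    avoids a p ma refl with () ← trans (sym a₁-free) ma

  kmatching-rankOne : (Z : KMatching rank a₁) → RankOne (kmatch Z)
  kmatching-rankOne Z a p za = proj₂ (kedge Z a p za)

  kmatching-avoids : (Z : KMatching rank a₁) → mate (kmatch Z) a₁ ≡ nothing
  kmatching-avoids Z with mate (kmatch Z) a₁ in za₁
  ... | nothing = refl
  ... | just p  = ⊥-elim (proj₁ (kedge Z a₁ p za₁) refl)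

  reassignK : (Z : KMatching rank a₁) (b : Fin nA) (q : Fin nP) → PostUnmatched (kmatch Z) q
    → KEdge rank a₁ b q → KMatching rank a₁
  reassignK Z b q q-free (b≢a₁ , bq) =
    asK (reassign (kmatch Z) b q q-free (1 , bq))
        (reassign-rankOne (kmatch Z) b q q-free bq (kmatching-rankOne Z))
        (trans (assign-other (mate (kmatch Z)) b (just q) a₁ (b≢a₁ ∘ sym)) (kmatching-avoids Z))

  kPart : Matching rank → KMatching rank a₁
  kPart M = asK (unmatch (rankOnePart M) a₁)
                (unmatch-rankOne (rankOnePart M) a₁ (rankOnePart-rankOne M))
                (assign-at (mate (rankOnePart M)) a₁ nothing)

  kPart-unmatched : ∀ (M : Matching rank) → mate (rankOnePart M) a₁ ≡ nothing
    → signature M 1 ≡ size (kmatch (kPart M))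
  kPart-unmatched M Ra₁ =
    trans (signature-rankOnePart M) (sym (size-unmatch-unmatched (rankOnePart M) a₁ Ra₁))

  kPart-matched : ∀ (M : Matching rank) {q} → mate (rankOnePart M) a₁ ≡ just q
    → signature M 1 ≡ suc (size (kmatch (kPart M))) × PostUnmatched (kmatch (kPart M)) q
  kPart-matched M Ra₁ =
    trans (signature-rankOnePart M) (size-unmatch-matched (rankOnePart M) a₁ Ra₁) ,
    unmatch-frees (rankOnePart M) a₁ Ra₁

module Alternating {nA nP : ℕ} (rank : Rank nA nP) (a₁ : Fin nA) (N : KMatching rank a₁) where

  open DecMembership (_≟_ {nP}) using (_∈?_)

  Even : Fin nP → Set
  Even = EvenPost rank a₁ N

  mN : Fin nA → Maybe (Fin nP)
  mN = mate (kmatch N)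

  Augmentation : KMatching rank a₁ → Set
  Augmentation Z = Σ (KMatching rank a₁) λ Z' → size (kmatch Z') ≡ suc (size (kmatch Z))

  agree : KMatching rank a₁ → Fin nA → Bool
  agree Z c = does (Maybe.≡-dec _≟_ (mate (kmatch Z) c) (mN c))

  agree-reassign : ∀ Z b q q-free ke → mN b ≡ just q
    → count (agree (reassignK a₁ Z b q q-free ke)) ≡ suc (count (agree Z))
  agree-reassign Z b q q-free ke Nb =
    count-insert (agree Z) (agree (reassignK a₁ Z b q q-free ke)) b
      (dec-false (Maybe.≡-dec _≟_ _ _) (λ Zb≡Nb → q-free b (trans Zb≡Nb Nb)))
      (dec-true (Maybe.≡-dec _≟_ _ _) (trans (assign-at (mate (kmatch Z)) b (just q)) (sym Nb)))
      (λ c c≢b → cong (λ v → does (Maybe.≡-dec _≟_ v (mN c)))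
                      (sym (assign-other (mate (kmatch Z)) b (just q) c c≢b)))

  -- If Z leaves q free, then q is even w.r.t. N or Z can be augmented:
  -- follow the N-edge (b,q); if b is free in Z, add (b,q); otherwise move b
  -- onto q and continue from b's old post.  The fuel k bounds the number of
  -- steps, since each step raises the agreement with N, which is at most nA.
  augment-or-even : ∀ k (Z : KMatching rank a₁) q → PostUnmatched (kmatch Z) q
    → nA < k + count (agree Z) → Even q ⊎ Augmentation Z
  augment-or-even zero Z q q-free bound = ⊥-elim (n≮n _ (≤-trans bound (count-≤ (agree Z))))
  augment-or-even (suc k) Z q q-free bound with any? (λ b → Maybe.≡-dec _≟_ (mN b) (just q))
  ... | no q-free-in-N = inj₁ (start q (λ a Na → q-free-in-N (a , Na)))
  ... | yes (b , Nb) = follow (mate (kmatch Z) b) refl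
    where
    ke : KEdge rank a₁ b q
    ke = kedge N b q Nb
    Z' : KMatching rank a₁
    Z' = reassignK a₁ Z b q q-free ke
    follow : ∀ x → mate (kmatch Z) b ≡ x → Even q ⊎ Augmentation Z
    follow nothing Zb = inj₂ (Z' , size-reassign-unmatched (kmatch Z) b q q-free (1 , proj₂ ke) Zb)
    follow (just q') Zb = extend (augment-or-even k Z' q' q'-free bound')
      where
      q≢q' : q ≢ q'
      q≢q' q≡q' = q-free b (trans Zb (cong just (sym q≡q')))
      q'-free : PostUnmatched (kmatch Z') q'
      q'-free = reassign-frees (kmatch Z) b q q-free (1 , proj₂ ke) q' Zb q≢q'
      bound' : nA < k + count (agree Z')
      bound' = subst (nA <_) (trans (sym (+-suc k _)) (cong (k +_) (sym (agree-reassign Z b q q-free ke Nb))))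
                 bound
      extend : Even q' ⊎ Augmentation Z' → Even q ⊎ Augmentation Z
      extend (inj₁ even-q') = inj₁ (step q' b q even-q' (kedge Z b q' Zb)
                                       (λ Nb≡q' → q≢q' (just-injective (trans (sym Nb) Nb≡q'))) Nb)
      extend (inj₂ (Z'' , larger)) =
        inj₂ (Z'' , trans larger (cong suc (size-reassign-matched (kmatch Z) b q q-free (1 , proj₂ ke) q' Zb)))

  posts : ∀ {p} → Even p → List (Fin nP)
  posts (start p _)          = p ∷ []
  posts (step _ _ p d _ _ _) = p ∷ posts d

  endpoint∈posts : ∀ {p} (d : Even p) → p ∈ posts d
  endpoint∈posts (start _ _)          = here refl
  endpoint∈posts (step _ _ _ _ _ _ _) = here refl

  AgreesOutside : KMatching rank a₁ → List (Fin nP) → Set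
  AgreesOutside Z S = ∀ c → mate (kmatch Z) c ≡ mN c ⊎ (∃ λ r → mN c ≡ just r × r ∈ S)

  Freeing : List (Fin nP) → Fin nP → Set
  Freeing S r = Σ (KMatching rank a₁) λ Z →
    size (kmatch Z) ≡ size (kmatch N) × PostUnmatched (kmatch Z) r × AgreesOutside Z S

  freeing-weaken : ∀ {S r} x → Freeing S r → Freeing (x ∷ S) r
  freeing-weaken x (Z , same-size , r-free , agrees) = Z , same-size , r-free , widen
    where
    widen : AgreesOutside Z (x ∷ _)
    widen c with agrees c
    ... | inj₁ Zc≡Nc          = inj₁ Zc≡Nc
    ... | inj₂ (r , Nc , r∈S) = inj₂ (r , Nc , there r∈S)

  -- At a step p' —a→ p, if p occurred earlier the path is shortcut;
  -- otherwise Z still uses the N-edge (a,p), and moving a onto p' frees p.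
  free-along : ∀ {p} (d : Even p) {r} → r ∈ posts d → Freeing (posts d) r
  free-along (start p p-free) (here refl) = N , refl , p-free , (λ c → inj₁ refl)
  free-along (step p' a p d ke Na≢p' Na) (there r∈) = freeing-weaken p (free-along d r∈)
  free-along (step p' a p d ke Na≢p' Na) (here refl) with p ∈? posts d
  ... | yes p∈ = freeing-weaken p (free-along d p∈)
  ... | no p∉ with free-along d (endpoint∈posts d)
  ...   | Z , same-size , p'-free , agrees =
    Z' , trans (size-reassign-matched (kmatch Z) a p' p'-free (1 , proj₂ ke) p Za) same-size
       , reassign-frees (kmatch Z) a p' p'-free (1 , proj₂ ke) p Za p'≢p
       , agrees'
    where
    Za : mate (kmatch Z) a ≡ just p
    Za with agrees a
    ... | inj₁ Za≡Na           = trans Za≡Na Na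
    ... | inj₂ (r , Na' , r∈) = ⊥-elim (p∉ (subst (_∈ posts d) (just-injective (trans (sym Na') Na)) r∈))
    p'≢p : p' ≢ p
    p'≢p p'≡p = Na≢p' (trans Na (cong just (sym p'≡p)))
    Z' : KMatching rank a₁
    Z' = reassignK a₁ Z a p' p'-free ke
    agrees' : AgreesOutside Z' (p ∷ posts d)
    agrees' c with assign-cases (mate (kmatch Z)) a (just p') c
    ... | inj₁ (refl , _) = inj₂ (p , Na , here refl)
    ... | inj₂ (_ , Z'c) with agrees c
    ...   | inj₁ Zc≡Nc          = inj₁ (trans Z'c Zc≡Nc)
    ...   | inj₂ (r , Nc , r∈S) = inj₂ (r , Nc , there r∈S)

  -- If a rank-one post p of a₁ is even, freeing p and adding (a₁,p) gives a
  -- rank-one matching of size |N|+1; so a rank-maximal M has that many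
  -- rank-one edges.
  rankMaximal-exceeds-N : PositiveRanks rank → ∀ {p} → rank a₁ p ≡ just 1 → Even p
    → ∀ (M : Matching rank) → RankMaximal rank M → suc (size (kmatch N)) ≤ signature M 1
  rankMaximal-exceeds-N positive {p} a₁p even-p M rank-maximal
    with free-along even-p (endpoint∈posts even-p)
  ... | Z , same-size , p-free , _ =
    subst (_≤ signature M 1) Y-size (rankMaximal-maximizes-rankOne positive M rank-maximal Y)
    where
    Y : Matching rank
    Y = reassign (kmatch Z) a₁ p p-free (1 , a₁p)
    Y-size : signature Y 1 ≡ suc (size (kmatch N))
    Y-size = begin
      signature Y 1
        ≡⟨ signature-rankOne Y (reassign-rankOne (kmatch Z) a₁ p p-free a₁p (kmatching-rankOne a₁ Z)) ⟩
      size Y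
        ≡⟨ size-reassign-unmatched (kmatch Z) a₁ p p-free (1 , a₁p) (kmatching-avoids a₁ Z) ⟩
      suc (size (kmatch Z))
        ≡⟨ cong suc same-size ⟩
      suc (size (kmatch N)) ∎
      where open ≡-Reasoning

lemma3 : ∀ {nA nP : ℕ} (rank : Rank nA nP) → PositiveRanks rank
    → (a₁ : Fin nA) (N : KMatching rank a₁) → IsMaximumK N
    → (∃ λ p → rank a₁ p ≡ just 1 × NonFPost rank a₁ N p)
    → ∀ (M : Matching rank) → RankMaximal rank M
    → ∃ λ p → mate M a₁ ≡ just p × rank a₁ p ≡ just 1 × NonFPost rank a₁ N p
lemma3 {nA} rank positive a₁ N N-maximum (p , a₁p , even-p) M rank-maximal
  with Alternating.rankMaximal-exceeds-N rank a₁ N positive a₁p even-p M rank-maximal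
     | mate (rankOnePart M) a₁ in Ra₁
... | exceeds | nothing =
  -- a₁ has no rank-one edge in M, so M has at most |N| rank-one edges
  ⊥-elim (n≮n _ (≤-trans exceeds (subst (_≤ _) (sym (kPart-unmatched a₁ M Ra₁)) (N-maximum (kPart a₁ M)))))
... | exceeds | just q with kPart-matched a₁ M Ra₁
...   | M-size , q-free
  with Alternating.augment-or-even rank a₁ N (suc nA) (kPart a₁ M) q q-free (m≤m+n (suc nA) _)
...     | inj₁ even-q = q , proj₁ (rankOneMate-sub M a₁ q Ra₁) , proj₂ (rankOneMate-sub M a₁ q Ra₁) , even-q
...     | inj₂ (L' , larger) =
  -- kPart M is already as large as N, so it cannot be augmented
  ⊥-elim (n≮n _ (≤-trans (s≤s N≤L) (subst (_≤ _) larger (N-maximum L'))))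
  where
  N≤L : size (kmatch N) ≤ size (kmatch (kPart a₁ M))
  N≤L = s≤s⁻¹ (subst (_ ≤_) M-size exceeds)
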